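{- Let $\alpha,\gamma$ be snowy weak compositions. If $\alpha$ is larger than $\gamma$ in tail-lexicographical order, then $\mathsf{rajcode}(\alpha)$ is larger than $\mathsf{rajcode}(\gamma)$ in tail-lexicographical order.
   Context: A weak composition is an infinite sequence $\alpha=(\alpha_1,\alpha_2,\dots)$ of non-negative integers with finitely many positive entries. It is snowy if its positive entries are pairwise distinct. Tail-lexicographical order: $\alpha$ is larger than $\gamma$ if there is $i$ with $\alpha_j=\gamma_j$ for all $j>i$ and $\alpha_i>\gamma_i$. For a snowy weak composition $\alpha$, $\mathsf{rajcode}(\alpha)$ is the weak composition with $\mathsf{rajcode}(\alpha)_i=\alpha_i+|\{j>i:\alpha_j>\alpha_i\}|$. -}

module Defs where

open import Data.Nat using (ℕ; zero; suc; _+_; _≤_; _<_; _<?_)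
open import Data.Nat.Properties using (≤-refl)
open import Data.Product using (Σ; ∃; _×_; _,_; proj₁)
open import Relation.Binary.PropositionalEquality using (_≡_)
open import Relation.Nullary using (¬_; does)
open import Data.Bool using (if_then_else_)

-- A weak composition: a sequence of naturals (indexed from 0 here,
-- i.e. entry i of the paper is entry (i - 1) here) together with a
-- bound beyond which all entries vanish.
record WeakComp : Set where
  constructor wc
  field
    entry   : ℕ → ℕ
    bound   : ℕ
    support : ∀ i → bound ≤ i → entry i ≡ 0
open WeakComp public

Snowy : WeakComp → Set
Snowy α = ∀ i j → 0 < entry α i → entry α i ≡ entry α j → i ≡ j

TailLexGt : (ℕ → ℕ) → (ℕ → ℕ) → Set
TailLexGt a c = ∃ λ i → (∀ j → i < j → a j ≡ c j) × c i < a i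

countAbove : (ℕ → ℕ) → ℕ → ℕ → ℕ → ℕ
countAbove f v lo zero = 0
countAbove f v lo (suc k) =
  (if does (v <? f lo) then 1 else 0) + countAbove f v (suc lo) k

-- |{ j > i : α_j > α_i }| ; all such j lie below the bound, so counting
-- j in the range (i, i + bound] suffices (the range i+1 .. i+bound covers all j < bound).
largerAfter : WeakComp → ℕ → ℕ
largerAfter α i = countAbove (entry α) (entry α i) (suc i) (bound α)

rajcodeEntry : WeakComp → ℕ → ℕ
rajcodeEntry α i = entry α i + largerAfter α i

-- Write a = γ_i < α_i = b for the last position i where α and γ differ.  Beyond i the
-- rajcodes agree.  At i, every later entry exceeding a either exceeds b or lies strictly
-- between a and b (it cannot equal b, as α is snowy); the positive entries after i are
-- distinct, so at most b - a - 1 of them lie strictly between a and b.  Hence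
-- rajcode(γ)_i ≤ a + (b - a - 1) + #{j > i : α_j > b} < rajcode(α)_i.
module Submission where

open import Defs
open import Data.Nat using (ℕ; zero; suc; _+_; _*_; _≤_; _<_; _<?_; _≟_; z≤n; s≤s)
open import Data.Nat.Properties
open import Algebra.Properties.CommutativeSemigroup +-commutativeSemigroup using (interchange)
open import Data.Product using (_,_)
open import Data.Sum using (inj₁; inj₂)
open import Data.Bool using (if_then_else_)
open import Data.Empty using (⊥-elim)
open import Function using (_∘_)
open import Relation.Binary.PropositionalEquality
open import Relation.Binary.Definitions using (tri<; tri≈; tri>)
open import Relation.Nullary using (¬_; Dec; does; yes; no)
open import Relation.Nullary.Decidable using (dec-true; dec-false)

𝟙 : {P : Set} → Dec P → ℕ
𝟙 d = if does d then 1 else 0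

𝟙-yes : {P : Set} (d : Dec P) → P → 𝟙 d ≡ 1
𝟙-yes d p rewrite dec-true d p = refl

𝟙-no : {P : Set} (d : Dec P) → ¬ P → 𝟙 d ≡ 0
𝟙-no d ¬p rewrite dec-false d ¬p = refl

sumFrom : (ℕ → ℕ) → ℕ → ℕ → ℕ
sumFrom g lo zero    = 0
sumFrom g lo (suc k) = g lo + sumFrom g (suc lo) k

module _ {g h : ℕ → ℕ} where

  sumFrom-cong : ∀ {lo} k → (∀ t → lo ≤ t → g t ≡ h t) → sumFrom g lo k ≡ sumFrom h lo k
  sumFrom-cong zero    g≗h = refl
  sumFrom-cong (suc k) g≗h =
    cong₂ _+_ (g≗h _ ≤-refl) (sumFrom-cong k (λ t lo<t → g≗h t (<⇒≤ lo<t)))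

  sumFrom-+ : ∀ lo k → sumFrom (λ t → g t + h t) lo k ≡ sumFrom g lo k + sumFrom h lo k
  sumFrom-+ lo zero    = refl
  sumFrom-+ lo (suc k) = begin
    g lo + h lo + sumFrom (λ t → g t + h t) (suc lo) k
      ≡⟨ cong (g lo + h lo +_) (sumFrom-+ (suc lo) k) ⟩
    g lo + h lo + (sumFrom g (suc lo) k + sumFrom h (suc lo) k)
      ≡⟨ interchange (g lo) (h lo) _ _ ⟩
    g lo + sumFrom g (suc lo) k + (h lo + sumFrom h (suc lo) k) ∎
    where open ≡-Reasoning

sumFrom-zero : ∀ {g lo} k → (∀ t → lo ≤ t → g t ≡ 0) → sumFrom g lo k ≡ 0
sumFrom-zero zero    g≗0 = refl
sumFrom-zero (suc k) g≗0 rewrite g≗0 _ ≤-refl = sumFrom-zero k (λ t lo<t → g≗0 t (<⇒≤ lo<t))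

sumFrom-extend : ∀ {g lo k n} → k ≤ n → (∀ t → lo + k ≤ t → g t ≡ 0) →
                 sumFrom g lo n ≡ sumFrom g lo k
sumFrom-extend {k = zero}  {n}     z≤n       g≗0 =
  sumFrom-zero n (λ t → g≗0 t ∘ ≤-trans (≤-reflexive (+-identityʳ _)))
sumFrom-extend {k = suc k} {suc n} (s≤s k≤n) g≗0 =
  cong (_ +_) (sumFrom-extend k≤n (λ t → g≗0 t ∘ ≤-trans (≤-reflexive (+-suc _ k))))

countAbove≡sumFrom : ∀ f v lo k → countAbove f v lo k ≡ sumFrom (λ t → 𝟙 (v <? f t)) lo k
countAbove≡sumFrom f v lo zero    = refl
countAbove≡sumFrom f v lo (suc k) = cong (_ +_) (countAbove≡sumFrom f v (suc lo) k)

largerAfter-within : ∀ α j {n} → bound α ≤ n →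
  largerAfter α j ≡ sumFrom (λ t → 𝟙 (entry α j <? entry α t)) (suc j) n
largerAfter-within α j {n} bα≤n = begin
  largerAfter α j
    ≡⟨ countAbove≡sumFrom (entry α) (entry α j) (suc j) (bound α) ⟩
  sumFrom (λ t → 𝟙 (entry α j <? entry α t)) (suc j) (bound α)
    ≡⟨ sumFrom-extend bα≤n (λ t bα≤t → 𝟙-no (_ <? _) (n≮0 ∘ subst (entry α j <_) (vanishes t bα≤t))) ⟨
  sumFrom (λ t → 𝟙 (entry α j <? entry α t)) (suc j) n ∎
  where
  open ≡-Reasoning
  vanishes : ∀ t → suc j + bound α ≤ t → entry α t ≡ 0
  vanishes t = support α t ∘ ≤-trans (m≤n+m (bound α) (suc j))

between : ℕ → ℕ → ℕ → ℕ
between a b x = 𝟙 (a <? x) * 𝟙 (x <? b)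

between-empty : ∀ a x → between a (suc a) x ≡ 0
between-empty a x with <-cmp a x
... | tri< a<x _ _ rewrite 𝟙-yes (a <? x) a<x | 𝟙-no (x <? suc a) (<⇒≱ a<x ∘ ≤-pred) = refl
... | tri≈ a≮x _ _ rewrite 𝟙-no (a <? x) a≮x = refl
... | tri> a≮x _ _ rewrite 𝟙-no (a <? x) a≮x = refl

between-extend : ∀ {a c} x → a < c → between a (suc c) x ≡ between a c x + 𝟙 (x ≟ c)
between-extend {a} {c} x a<c with <-cmp x c
... | tri< x<c x≢c _
  rewrite 𝟙-yes (x <? suc c) (m≤n⇒m≤1+n x<c) | 𝟙-yes (x <? c) x<c | 𝟙-no (x ≟ c) x≢c
  = sym (+-identityʳ _)
... | tri≈ _ refl _
  rewrite 𝟙-yes (a <? x) a<c | 𝟙-yes (x <? suc x) ≤-refl | 𝟙-no (x <? x) (n≮n x) | 𝟙-yes (x ≟ x) refl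
  = refl
... | tri> _ x≢c c<x
  rewrite 𝟙-yes (a <? x) (<-trans a<c c<x) | 𝟙-no (x <? suc c) (<⇒≱ c<x ∘ ≤-pred)
        | 𝟙-no (x <? c) (<-asym c<x) | 𝟙-no (x ≟ c) x≢c
  = refl

above-split : ∀ {a b x} → a < b → x ≢ b → 𝟙 (a <? x) ≡ between a b x + 𝟙 (b <? x)
above-split {a} {b} {x} a<b x≢b with <-cmp x b
... | tri< x<b _ _ rewrite 𝟙-yes (x <? b) x<b | 𝟙-no (b <? x) (<-asym x<b) =
  sym (trans (+-identityʳ _) (*-identityʳ _))
... | tri≈ _ x≡b _ = ⊥-elim (x≢b x≡b)
... | tri> _ _ b<x
  rewrite 𝟙-yes (a <? x) (<-trans a<b b<x) | 𝟙-no (x <? b) (<-asym b<x) | 𝟙-yes (b <? x) b<x = refl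

PositiveInjective : (ℕ → ℕ) → Set
PositiveInjective f = ∀ s t → 0 < f s → f s ≡ f t → s ≡ t

count-≡-≤1 : ∀ {f c lo} k → 0 < c → PositiveInjective f →
             sumFrom (λ t → 𝟙 (f t ≟ c)) lo k ≤ 1
count-≡-≤1 zero _ _ = z≤n
count-≡-≤1 {f} {c} {lo} (suc k) 0<c inj with f lo ≟ c
... | no flo≢c rewrite 𝟙-no (f lo ≟ c) flo≢c = count-≡-≤1 k 0<c inj
... | yes flo≡c rewrite 𝟙-yes (f lo ≟ c) flo≡c =
  ≤-reflexive (cong suc (sumFrom-zero k (λ t lo<t → 𝟙-no (f t ≟ c) (ft≢c t lo<t))))
  where
  ft≢c : ∀ t → lo < t → f t ≢ c
  ft≢c t lo<t ft≡c = <-irrefl (inj lo t (subst (0 <_) (sym flo≡c) 0<c) (trans flo≡c (sym ft≡c))) lo<t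

count-between : ∀ {f a b lo} k → a < b → PositiveInjective f →
                a + sumFrom (between a b ∘ f) lo k < b
count-between {f} {a} {suc c} {lo} k a<b inj with m≤n⇒m<n∨m≡n (≤-pred a<b)
... | inj₂ refl rewrite sumFrom-zero {between a (suc a) ∘ f} {lo} k (λ t _ → between-empty a (f t)) =
  ≤-reflexive (cong suc (+-identityʳ a))
... | inj₁ a<c = s≤s (begin
  a + sumFrom (between a (suc c) ∘ f) lo k
    ≡⟨ cong (a +_) (sumFrom-cong k (λ t _ → between-extend (f t) a<c)) ⟩
  a + sumFrom (λ t → between a c (f t) + 𝟙 (f t ≟ c)) lo k
    ≡⟨ cong (a +_) (sumFrom-+ lo k) ⟩
  a + (sumFrom (between a c ∘ f) lo k + sumFrom (λ t → 𝟙 (f t ≟ c)) lo k)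
    ≡⟨ +-assoc a _ _ ⟨
  a + sumFrom (between a c ∘ f) lo k + sumFrom (λ t → 𝟙 (f t ≟ c)) lo k
    ≤⟨ +-monoʳ-≤ _ (count-≡-≤1 k (≤-trans (s≤s z≤n) a<c) inj) ⟩
  a + sumFrom (between a c ∘ f) lo k + 1
    ≡⟨ +-comm _ 1 ⟩
  suc (a + sumFrom (between a c ∘ f) lo k)
    ≤⟨ count-between k a<c inj ⟩
  c ∎)
  where open ≤-Reasoning

module _ (α γ : WeakComp) {i : ℕ} (agree : ∀ j → i < j → entry α j ≡ entry γ j) where

  private
    n = bound α + bound γ

  largerAfter-agree : ∀ j → i < j → largerAfter α j ≡ largerAfter γ j
  largerAfter-agree j i<j = begin
    largerAfter α j
      ≡⟨ largerAfter-within α j (m≤m+n (bound α) (bound γ)) ⟩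
    sumFrom (λ t → 𝟙 (entry α j <? entry α t)) (suc j) n
      ≡⟨ sumFrom-cong n (λ t j<t → cong₂ (λ u v → 𝟙 (u <? v)) (agree j i<j) (agree t (<-trans i<j j<t))) ⟩
    sumFrom (λ t → 𝟙 (entry γ j <? entry γ t)) (suc j) n
      ≡⟨ largerAfter-within γ j (m≤n+m (bound γ) (bound α)) ⟨
    largerAfter γ j ∎
    where open ≡-Reasoning

  rajcodeEntry-agree : ∀ j → i < j → rajcodeEntry α j ≡ rajcodeEntry γ j
  rajcodeEntry-agree j i<j = cong₂ _+_ (agree j i<j) (largerAfter-agree j i<j)

  rajcodeEntry-< : Snowy α → entry γ i < entry α i → rajcodeEntry γ i < rajcodeEntry α i
  rajcodeEntry-< snowy a<b = begin-strict
    a + largerAfter γ i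
      ≡⟨ cong (a +_) (largerAfter-within γ i (m≤n+m (bound γ) (bound α))) ⟩
    a + sumFrom (λ t → 𝟙 (a <? entry γ t)) (suc i) n
      ≡⟨ cong (a +_) (sumFrom-cong n (λ t i<t → cong (𝟙 ∘ (a <?_)) (agree t i<t))) ⟨
    a + sumFrom (λ t → 𝟙 (a <? f t)) (suc i) n
      ≡⟨ cong (a +_) (sumFrom-cong n (λ t i<t → above-split a<b (f≢b t i<t))) ⟩
    a + sumFrom (λ t → between a b (f t) + 𝟙 (b <? f t)) (suc i) n
      ≡⟨ trans (cong (a +_) (sumFrom-+ (suc i) n)) (sym (+-assoc a _ _)) ⟩
    a + sumFrom (between a b ∘ f) (suc i) n + sumFrom (λ t → 𝟙 (b <? f t)) (suc i) n
      <⟨ +-monoˡ-< _ (count-between n a<b snowy) ⟩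
    b + sumFrom (λ t → 𝟙 (b <? f t)) (suc i) n
      ≡⟨ cong (b +_) (largerAfter-within α i (m≤m+n (bound α) (bound γ))) ⟨
    b + largerAfter α i ∎
    where
    open ≤-Reasoning
    f = entry α
    a = entry γ i
    b = entry α i
    f≢b : ∀ t → i < t → f t ≢ b
    f≢b t i<t ft≡b = <-irrefl (snowy i t (<-≤-trans (s≤s z≤n) a<b) (sym ft≡b)) i<t

lemma2p5 : (α γ : WeakComp) → Snowy α → Snowy γ →
    TailLexGt (entry α) (entry γ) →
    TailLexGt (rajcodeEntry α) (rajcodeEntry γ)
lemma2p5 α γ snowy _ (i , agree , γi<αi) =
  i , rajcodeEntry-agree α γ agree , rajcodeEntry-< α γ agree snowy γi<αi
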